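{- Let $G$ be a graph with $r_2(G)=2k$ having a perfect odd cover $\{(X_1,Y_1),\ldots,(X_k,Y_k)\}$. If $B\subseteq V(G)$ is a set of vertices whose rows in the adjacency matrix $A_G$ form a basis of the row space of $A_G$ over $\mathbb{F}_2$, then $B$ is a complete system of distinct representatives for the collection of sets $\{X_1,Y_1,\ldots,X_k,Y_k\}$, i.e. the $2k$ vertices of $B$ can be ordered $x_1,y_1,\ldots,x_k,y_k$ with $x_i\in X_i$ and $y_i\in Y_i$ for all $i$.
   Context: Graphs are finite and simple; $r_2(G)$ is the rank over $\mathbb{F}_2$ of the adjacency matrix $A_G$. A biclique $(X,Y)$ on $V(G)$ is a complete bipartite graph with disjoint parts $X,Y\subseteq V(G)$. An odd cover of $G$ is a collection of bicliques such that each edge of $G$ is covered by an odd number of them and each nonedge by an even number. A perfect odd cover is an odd cover of cardinality $r_2(G)/2$. -}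

module Defs where

open import Data.Nat using (ℕ; zero; suc; _+_; _≤_)
open import Data.Bool using (Bool; true; false; _xor_; _∧_; _∨_; if_then_else_)
open import Data.Fin using (Fin; zero; suc)
open import Data.Product using (Σ; ∃; _×_; _,_)
open import Data.Empty using (⊥)
open import Relation.Nullary using (¬_)
open import Relation.Binary.PropositionalEquality using (_≡_; _≢_)

-- A (finite simple) graph on the vertex set Fin n, given by its adjacency
-- matrix over F₂ = Bool (true = 1, xor = addition, ∧ = multiplication).
record Graph (n : ℕ) : Set where
  field
    adj       : Fin n → Fin n → Bool
    symmetric : ∀ u v → adj u v ≡ adj v u
    irreflex  : ∀ v → adj v v ≡ false
open Graph public

VSet : ℕ → Set
VSet n = Fin n → Bool

_∈ᵥ_ : ∀ {n} → Fin n → VSet n → Set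
v ∈ᵥ S = S v ≡ true

xorSum : ∀ {m} → (Fin m → Bool) → Bool
xorSum {zero}  f = false
xorSum {suc m} f = f zero xor xorSum (λ i → f (suc i))

size : ∀ {n} → VSet n → ℕ
size {zero}  S = 0
size {suc n} S = (if S zero then 1 else 0) + size (λ i → S (suc i))

rowComb : ∀ {n} → Graph n → (Fin n → Bool) → Fin n → Bool
rowComb G c j = xorSum (λ v → c v ∧ adj G v j)

SupportedIn : ∀ {n} → (Fin n → Bool) → VSet n → Set
SupportedIn {n} c S = ∀ (v : Fin n) → c v ≡ true → v ∈ᵥ S

RowsIndependent : ∀ {n} → Graph n → VSet n → Set
RowsIndependent {n} G S =
  ∀ (c : Fin n → Bool) → SupportedIn c S →
  (∀ j → rowComb G c j ≡ false) → ∀ v → c v ≡ false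

RowsSpan : ∀ {n} → Graph n → VSet n → Set
RowsSpan {n} G S =
  ∀ (u : Fin n) → Σ (Fin n → Bool) λ c → SupportedIn c S ×
    (∀ j → rowComb G c j ≡ adj G u j)

RowBasis : ∀ {n} → Graph n → VSet n → Set
RowBasis G B = RowsIndependent G B × RowsSpan G B

Rank₂ : ∀ {n} → Graph n → ℕ → Set
Rank₂ G r =
  (∃ λ S → size S ≡ r × RowsIndependent G S) ×
  (∀ S → RowsIndependent G S → size S ≤ r)

record Bicliques (n k : ℕ) : Set where
  field
    X        : Fin k → VSet n
    Y        : Fin k → VSet n
    disjoint : ∀ i v → ¬ (v ∈ᵥ X i × v ∈ᵥ Y i)
open Bicliques public

covers : ∀ {n k} → Bicliques n k → Fin k → Fin n → Fin n → Bool
covers F i u v = (X F i u ∧ Y F i v) ∨ (Y F i u ∧ X F i v)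

OddCover : ∀ {n k} → Graph n → Bicliques n k → Set
OddCover {n} G F =
  ∀ (u v : Fin n) → u ≢ v → xorSum (λ i → covers F i u v) ≡ adj G u v

{-# OPTIONS --safe #-}
module Submission where

-- Over F₂ the odd cover factors the adjacency matrix as A_G = M N, where the 2k
-- columns of M are the indicator vectors of X₁ … X_k, Y₁ … Y_k and N pairs each
-- of them with the opposite part. A dependency among the B-rows of M would be one
-- among the B-rows of A_G, so the submatrix of M on the |B| = 2k rows of B is a
-- nonsingular square matrix. A nonsingular 0/1 matrix has a nonzero term in its
-- determinant: a bijection σ from B to the columns with M[b, σ b] = 1, which is
-- exactly a system of distinct representatives.

open import Defs
open import Data.Nat using (ℕ; _*_)
open import Data.Fin using (Fin)
open import Data.Sum using (_⊎_; inj₁; inj₂)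
open import Data.Product using (Σ; ∃; _×_; _,_)
open import Function.Definitions using (Injective)
open import Function.Bundles using (_⇔_)
open import Relation.Binary.PropositionalEquality using (_≡_)

open import Algebra.Bundles using (CommutativeRing)
open import Data.Bool using (Bool; true; false; _∧_; _xor_; if_then_else_)
open import Data.Bool.Properties
  using (xor-∧-commutativeRing; ∧-assoc; ∧-distribʳ-xor; ∧-conicalˡ; ∧-conicalʳ;
         ∨-identityʳ; xor-identityʳ; xor-assoc; xor-same; ¬-not)
  renaming (_≟_ to _≟ᵇ_)
open import Data.Fin using (zero; suc; _↑ˡ_; _↑ʳ_; join; splitAt)
open import Data.Fin.Properties using (any?; all?; splitAt-join; join-splitAt; _≟_)
open import Data.Fin.Subset.Properties using (anySubset?)
open import Data.Nat using (zero; suc; _+_; _≤_; z≤n; s≤s)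
open import Data.Nat.Properties using (+-suc; +-identityʳ; ≤-trans; ≤-antisym; n≤1+n; 1+n≰n; suc-injective)
open import Data.Product using (proj₁; proj₂)
open import Data.Vec using (lookup; tabulate)
open import Data.Vec.Properties using (lookup∘tabulate)
open import Data.Vec.Functional using (tail; updateAt; _++_)
open import Data.Vec.Functional.Properties using (updateAt-updates; updateAt-minimal; lookup-++ˡ; lookup-++ʳ)
open import Function using (_∘_; const)
open import Function.Bundles using (mk⇔)
open import Relation.Binary.PropositionalEquality using (_≢_; _≗_; refl; sym; trans; cong; cong₂; subst; module ≡-Reasoning)
open import Relation.Nullary using (Dec; yes; no; ¬_; contradiction)
open import Relation.Nullary.Decidable using (_×-dec_; _→-dec_)

open CommutativeRing xor-∧-commutativeRing using (semiring)
open import Algebra.Properties.Semiring.Sum semiring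
  using (sum; sum-syntax; sum-cong-≗; sum-replicate-zero; ∑-distrib-+; ∑-comm; *-distribˡ-sum; *-distribʳ-sum)

false≢true : false ≢ true
false≢true ()

private
  variable
    k m n p : ℕ

xorSum≡sum : (f : Fin m → Bool) → xorSum f ≡ sum f
xorSum≡sum {zero}  f = refl
xorSum≡sum {suc m} f = cong (f zero xor_) (xorSum≡sum (f ∘ suc))

sum-false : {f : Fin m → Bool} → (∀ i → f i ≡ false) → sum f ≡ false
sum-false {m} f≡0 = trans (sum-cong-≗ f≡0) (sum-replicate-zero m)

sum≡true⇒∃ : (f : Fin m → Bool) → sum f ≡ true → ∃ λ i → f i ≡ true
sum≡true⇒∃ {zero}  f ()
sum≡true⇒∃ {suc m} f Σf with f zero in f₀
... | true  = zero , f₀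
... | false with sum≡true⇒∃ (f ∘ suc) Σf
...   | i , fi = suc i , fi

sum-↑ : (f : Fin (m + n) → Bool) → sum f ≡ sum (f ∘ (_↑ˡ n)) xor sum (f ∘ (m ↑ʳ_))
sum-↑ {zero}  f = refl
sum-↑ {suc m} {n} f = trans (cong (f zero xor_) (sum-↑ {m} {n} (f ∘ suc))) (sym (xor-assoc (f zero) _ _))

Matrix : ℕ → ℕ → Set
Matrix m n = Fin m → Fin n → Bool

infixl 7 _·_

_·_ : Matrix m p → Matrix p n → Matrix m n
(P · Q) r j = ∑[ t < _ ] (P r t ∧ Q t j)

combination : (Fin m → Bool) → Matrix m n → Fin n → Bool
combination c M t = ∑[ r < _ ] (c r ∧ M r t)

combination-xor : (c d : Fin m → Bool) (M : Matrix m n) (t : Fin n) →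
  combination (λ r → c r xor d r) M t ≡ combination c M t xor combination d M t
combination-xor c d M t = trans
  (sum-cong-≗ (λ r → ∧-distribʳ-xor (M r t) (c r) (d r)))
  (∑-distrib-+ (λ r → c r ∧ M r t) (λ r → d r ∧ M r t))

combination-· : (c : Fin m → Bool) (P : Matrix m p) (Q : Matrix p n) (j : Fin n) →
  combination c (P · Q) j ≡ combination (combination c P) Q j
combination-· {m} {p} c P Q j = begin
  ∑[ r < m ] (c r ∧ ∑[ t < p ] (P r t ∧ Q t j))  ≡⟨ sum-cong-≗ (λ r → *-distribˡ-sum (c r) (λ t → P r t ∧ Q t j)) ⟩
  ∑[ r < m ] ∑[ t < p ] (c r ∧ (P r t ∧ Q t j))  ≡⟨ ∑-comm (λ r t → c r ∧ (P r t ∧ Q t j)) ⟩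
  ∑[ t < p ] ∑[ r < m ] (c r ∧ (P r t ∧ Q t j))  ≡⟨ sum-cong-≗ (λ t → sum-cong-≗ (λ r → ∧-assoc (c r) (P r t) (Q t j))) ⟨
  ∑[ t < p ] ∑[ r < m ] ((c r ∧ P r t) ∧ Q t j)  ≡⟨ sum-cong-≗ (λ t → *-distribʳ-sum (Q t j) (λ r → c r ∧ P r t)) ⟨
  ∑[ t < p ] (∑[ r < m ] (c r ∧ P r t) ∧ Q t j)  ∎
  where open ≡-Reasoning

combination-vanishes : {c : Fin m → Bool} {B : VSet m} (M : Matrix m n) (t : Fin n) →
  SupportedIn c B → (∀ r → r ∈ᵥ B → M r t ≡ false) → combination c M t ≡ false
combination-vanishes {c = c} M t c⊆B Mt≡0 = sum-false vanishes
  where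
  vanishes : ∀ r → c r ∧ M r t ≡ false
  vanishes r with c r in cr
  ... | false = refl
  ... | true  = Mt≡0 r (c⊆B r cr)

remove : VSet n → Fin n → VSet n
remove B i = updateAt B i (const false)

remove-self : (B : VSet n) (i : Fin n) → remove B i i ≡ false
remove-self B i = updateAt-updates i B

remove-⊆ : (B : VSet n) (i v : Fin n) → v ∈ᵥ remove B i → v ∈ᵥ B
remove-⊆ B i v v∈ with v ≟ i
... | yes refl = contradiction (trans (sym (remove-self B v)) v∈) false≢true
... | no v≢i   = trans (sym (updateAt-minimal v i B v≢i)) v∈

remove-other : (B : VSet n) (i v : Fin n) → v ∈ᵥ B → v ≢ i → v ∈ᵥ remove B i
remove-other B i v v∈B v≢i = trans (updateAt-minimal v i B v≢i) v∈B

size-remove : (B : VSet n) (i : Fin n) → i ∈ᵥ B → size B ≡ suc (size (remove B i))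
size-remove B zero    i∈B rewrite i∈B = refl
size-remove B (suc i) i∈B =
  trans (cong ((if B zero then 1 else 0) +_) (size-remove (tail B) i i∈B)) (+-suc _ _)

full : VSet n
full = const true

size-full : size {n} full ≡ n
size-full {zero}  = refl
size-full {suc n} = cong suc (size-full {n})

size-empty : (B : VSet n) → (∀ v → B v ≡ false) → size B ≡ 0
size-empty {zero}  B B≡∅ = refl
size-empty {suc n} B B≡∅ rewrite B≡∅ zero = size-empty (tail B) (B≡∅ ∘ suc)

RowsIndependentOn : Matrix n m → VSet n → VSet m → Set
RowsIndependentOn M B C =
  ∀ c → SupportedIn c B → (∀ t → t ∈ᵥ C → combination c M t ≡ false) → ∀ v → c v ≡ false

Dependency : Matrix n m → VSet n → VSet m → (Fin n → Bool) → Set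
Dependency M B C d =
  SupportedIn d B × (∀ t → t ∈ᵥ C → combination d M t ≡ false) × ∃ λ v → d v ≡ true

dependency? : (M : Matrix n m) (B : VSet n) (C : VSet m) (d : Fin n → Bool) → Dec (Dependency M B C d)
dependency? M B C d =
  all? (λ v → (d v ≟ᵇ true) →-dec (B v ≟ᵇ true)) ×-dec
  all? (λ t → (C t ≟ᵇ true) →-dec (combination d M t ≟ᵇ false)) ×-dec
  any? (λ v → d v ≟ᵇ true)

dependency-cong : {M : Matrix n m} {B : VSet n} {C : VSet m} {d e : Fin n → Bool} →
  d ≗ e → Dependency M B C d → Dependency M B C e
dependency-cong {M = M} d≗e (d⊆B , d-comb , v , dv) =
  (λ u eu → d⊆B u (trans (d≗e u) eu)) ,
  (λ t t∈C → trans (sum-cong-≗ (λ r → cong (_∧ M r t) (sym (d≗e r)))) (d-comb t t∈C)) ,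
  (v , trans (sym (d≗e v)) dv)

independent-or-dependency : (M : Matrix n m) (B : VSet n) (C : VSet m) →
  RowsIndependentOn M B C ⊎ ∃ (Dependency M B C)
independent-or-dependency M B C with anySubset? (dependency? M B C ∘ lookup)
... | yes (s , dep) = inj₂ (lookup s , dep)
... | no ∄dep       = inj₁ λ c c⊆B c-comb v → ¬-not λ cv →
  ∄dep (tabulate c , dependency-cong (sym ∘ lookup∘tabulate c) (c⊆B , c-comb , v , cv))

independent-unique : {M : Matrix n m} {B : VSet n} {C : VSet m} {c d : Fin n → Bool} →
  RowsIndependentOn M B C → SupportedIn c B → SupportedIn d B →
  (∀ t → t ∈ᵥ C → combination c M t ≡ combination d M t) → c ≗ d
independent-unique {n} {m} {M} {B} {C} {c} {d} ind c⊆B d⊆B same v =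
  xor≡false⇒≡ (c v) (d v) (ind c+d c+d⊆B c+d-comb v)
  where
  c+d : Fin n → Bool
  c+d r = c r xor d r
  c+d⊆B : SupportedIn c+d B
  c+d⊆B u c+du with c u in cu
  ... | true  = c⊆B u cu
  ... | false = d⊆B u c+du
  c+d-comb : ∀ t → t ∈ᵥ C → combination c+d M t ≡ false
  c+d-comb t t∈C = trans (combination-xor c d M t)
    (trans (cong (_xor combination d M t) (same t t∈C)) (xor-same (combination d M t)))
  xor≡false⇒≡ : ∀ x y → x xor y ≡ false → x ≡ y
  xor≡false⇒≡ false false _ = refl
  xor≡false⇒≡ true  true  _ = refl

dropFirstColumn : Matrix n (suc m) → Matrix n m
dropFirstColumn M r t = M r (suc t)

Pivot : Matrix n (suc m) → VSet n → Set
Pivot M B = ∃ λ i → i ∈ᵥ B × M i zero ≡ true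

pivot? : (M : Matrix n (suc m)) (B : VSet n) → Dec (Pivot M B)
pivot? M B = any? (λ i → (B i ≟ᵇ true) ×-dec (M i zero ≟ᵇ true))

independent-dropFirstColumn : {M : Matrix n (suc m)} {B : VSet n} {C : VSet (suc m)} →
  RowsIndependentOn M B C →
  (∀ c → SupportedIn c B → zero ∈ᵥ C → combination c M zero ≡ false) →
  RowsIndependentOn (dropFirstColumn M) B (tail C)
independent-dropFirstColumn ind first c c⊆B c-comb =
  ind c c⊆B λ { zero 0∈C → first c c⊆B 0∈C ; (suc t) t∈C → c-comb t t∈C }

independent-dropUnusedFirstColumn : {M : Matrix n (suc m)} {B : VSet n} {C : VSet (suc m)} →
  RowsIndependentOn M B C → C zero ≡ false → RowsIndependentOn (dropFirstColumn M) B (tail C)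
independent-dropUnusedFirstColumn ind 0∉C =
  independent-dropFirstColumn ind λ _ _ 0∈C → contradiction (trans (sym 0∉C) 0∈C) false≢true

independent-dropEmptyFirstColumn : {M : Matrix n (suc m)} {B : VSet n} {C : VSet (suc m)} →
  RowsIndependentOn M B C → ¬ Pivot M B → RowsIndependentOn (dropFirstColumn M) B (tail C)
independent-dropEmptyFirstColumn {M = M} ind ∄pivot =
  independent-dropFirstColumn ind λ _ c⊆B _ →
    combination-vanishes M zero c⊆B λ r r∈B → ¬-not λ Mr → ∄pivot (r , r∈B , Mr)

-- The exchange step behind Laplace expansion along the first column. If removing
-- i₀ loses independence, a dependency d of B - i₀ on the later columns is nonzero
-- on the first one, since B is independent, and any row of d with a one there works.
independent-pivot : {M : Matrix n (suc m)} {B : VSet n} {C : VSet (suc m)} →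
  RowsIndependentOn M B C → Pivot M B →
  ∃ λ i → i ∈ᵥ B × M i zero ≡ true × RowsIndependentOn (dropFirstColumn M) (remove B i) (tail C)
independent-pivot {n = n} {M = M} {B} {C} ind (i₀ , i₀∈B , Mi₀)
  with independent-or-dependency (dropFirstColumn M) (remove B i₀) (tail C)
... | inj₁ ind₀ = i₀ , i₀∈B , Mi₀ , ind₀
... | inj₂ (d , d⊆B-i₀ , d-comb , w , dw) = i , d⊆B i di , Mi , ind′
  where
  d⊆B : SupportedIn d B
  d⊆B v dv = remove-⊆ B i₀ v (d⊆B-i₀ v dv)

  d-first : combination d M zero ≡ true
  d-first = ¬-not λ d₀ →
    false≢true (trans (sym (ind d d⊆B (λ { zero _ → d₀ ; (suc t) → d-comb t }) w)) dw)

  pivot : ∃ λ i → d i ∧ M i zero ≡ true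
  pivot = sum≡true⇒∃ _ d-first

  i : Fin n
  i = proj₁ pivot

  di : d i ≡ true
  di = ∧-conicalˡ (d i) (M i zero) (proj₂ pivot)

  Mi : M i zero ≡ true
  Mi = ∧-conicalʳ (d i) (M i zero) (proj₂ pivot)

  -- If such a combination e did not vanish on the first column, it would agree
  -- with d on every column, hence equal d and use the removed row i.
  ind′ : RowsIndependentOn (dropFirstColumn M) (remove B i) (tail C)
  ind′ e e⊆B-i e-comb = ind e e⊆B λ { zero _ → e-first ; (suc t) → e-comb t }
    where
    e⊆B : SupportedIn e B
    e⊆B u eu = remove-⊆ B i u (e⊆B-i u eu)

    e≗d : combination e M zero ≡ true → e ≗ d
    e≗d e₀ = independent-unique ind e⊆B d⊆B λ
      { zero _ → trans e₀ (sym d-first) ; (suc t) t∈C → trans (e-comb t t∈C) (sym (d-comb t t∈C)) }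

    e-first : combination e M zero ≡ false
    e-first = ¬-not λ e₀ →
      false≢true (trans (sym (remove-self B i)) (e⊆B-i i (trans (e≗d e₀ i) di)))

independent⇒size≤ : {M : Matrix n m} {B : VSet n} {C : VSet m} →
  RowsIndependentOn M B C → size B ≤ size C
independent⇒size≤ {m = zero} {B = B} ind
  rewrite size-empty B (ind B (λ _ v∈B → v∈B) λ ()) = z≤n
independent⇒size≤ {m = suc m} {M = M} {B} {C} ind with C zero in c₀ | pivot? M B
... | false | _ = independent⇒size≤ (independent-dropUnusedFirstColumn ind c₀)
... | true  | no ∄pivot =
  ≤-trans (independent⇒size≤ (independent-dropEmptyFirstColumn ind ∄pivot)) (n≤1+n _)
... | true  | yes pivot with independent-pivot ind pivot
...   | i , i∈B , _ , ind′ rewrite size-remove B i i∈B = s≤s (independent⇒size≤ ind′)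

record Transversal (M : Matrix n m) (B : VSet n) : Set where
  field
    row       : Fin m → Fin n
    injective : Injective _≡_ _≡_ row
    row-∈     : ∀ t → row t ∈ᵥ B
    onto      : ∀ v → v ∈ᵥ B → ∃ λ t → row t ≡ v
    hits      : ∀ t → M (row t) t ≡ true

transversal-cons : {M : Matrix n (suc m)} {B : VSet n} (i : Fin n) → i ∈ᵥ B → M i zero ≡ true →
  Transversal (dropFirstColumn M) (remove B i) → Transversal M B
transversal-cons {n} {m} {M} {B} i i∈B Mi T = record
  { row = row ; injective = injective ; row-∈ = row-∈ ; onto = onto ; hits = hits }
  where
  module T = Transversal T

  row : Fin (suc m) → Fin n
  row zero    = i
  row (suc t) = T.row t

  later-row≢i : ∀ t → T.row t ≢ i
  later-row≢i t eq = false≢true (trans (sym (remove-self B i)) (subst (_∈ᵥ remove B i) eq (T.row-∈ t)))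

  injective : Injective _≡_ _≡_ row
  injective {zero}  {zero}  _  = refl
  injective {zero}  {suc t} eq = contradiction (sym eq) (later-row≢i t)
  injective {suc t} {zero}  eq = contradiction eq (later-row≢i t)
  injective {suc t} {suc u} eq = cong suc (T.injective eq)

  row-∈ : ∀ t → row t ∈ᵥ B
  row-∈ zero    = i∈B
  row-∈ (suc t) = remove-⊆ B i (T.row t) (T.row-∈ t)

  onto : ∀ v → v ∈ᵥ B → ∃ λ t → row t ≡ v
  onto v v∈B with v ≟ i
  ... | yes refl = zero , refl
  ... | no v≢i with T.onto v (remove-other B i v v∈B v≢i)
  ...   | t , eq = suc t , eq

  hits : ∀ t → M (row t) t ≡ true
  hits zero    = Mi
  hits (suc t) = T.hits t

independent-square⇒transversal : {M : Matrix n m} {B : VSet n} →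
  RowsIndependentOn M B full → size B ≡ m → Transversal M B
independent-square⇒transversal {m = zero} {B = B} ind _ = record
  { row = λ () ; injective = λ {} ; row-∈ = λ () ; hits = λ ()
  ; onto = λ v v∈B → contradiction (trans (sym (ind B (λ _ u∈B → u∈B) (λ ()) v)) v∈B) false≢true }
independent-square⇒transversal {m = suc m} {M = M} {B} ind |B| with pivot? M B
... | no ∄pivot = contradiction (subst (_≤ m) |B| (subst (size B ≤_) size-full |B|≤|full|)) 1+n≰n
  where
  |B|≤|full| : size B ≤ size {m} full
  |B|≤|full| = independent⇒size≤ (independent-dropEmptyFirstColumn ind ∄pivot)
... | yes pivot with independent-pivot ind pivot
...   | i , i∈B , Mi , ind′ = transversal-cons i i∈B Mi
  (independent-square⇒transversal ind′ (suc-injective (trans (sym (size-remove B i i∈B)) |B|)))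

independent-factor : {A : Matrix n m} {P : Matrix n p} {Q : Matrix p m} {S : VSet n} {C : VSet p} →
  (∀ r j → A r j ≡ (P · Q) r j) → RowsIndependentOn A S full →
  (∀ r t → C t ≡ false → P r t ≡ false) → RowsIndependentOn P S C
independent-factor {A = A} {P} {Q} {S} {C} A≡P·Q ind P⊆C c c⊆S c-comb = ind c c⊆S λ j _ → begin
  combination c A j                  ≡⟨ sum-cong-≗ (λ r → cong (c r ∧_) (A≡P·Q r j)) ⟩
  combination c (P · Q) j            ≡⟨ combination-· c P Q j ⟩
  combination (combination c P) Q j  ≡⟨ sum-false (λ t → cong (_∧ Q t j) (cP≡0 t)) ⟩
  false                              ∎
  where
  open ≡-Reasoning
  cP≡0 : ∀ t → combination c P t ≡ false
  cP≡0 t with C t in ct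
  ... | true  = c-comb t ct
  ... | false = combination-vanishes P t c⊆S λ r _ → P⊆C r t ct

rowsIndependent⇒rowsIndependentOn : {G : Graph n} {B : VSet n} →
  RowsIndependent G B → RowsIndependentOn (adj G) B full
rowsIndependent⇒rowsIndependentOn {G = G} ind c c⊆B c-comb =
  ind c c⊆B λ j → trans (xorSum≡sum (λ r → c r ∧ adj G r j)) (c-comb j refl)

rowBasis⇒size≡rank : {G : Graph n} {B : VSet n} {r : ℕ} → Rank₂ G r → RowBasis G B → size B ≡ r
rowBasis⇒size≡rank {n} {G} {B} ((S , |S| , indS) , maximal) (indB , spanB) =
  ≤-antisym (maximal B indB) (subst (_≤ size B) |S| (independent⇒size≤ coefficients-indS))
  where
  -- The rows of S are combinations of the rows of B, with independent coefficients.
  coefficients : Matrix n n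
  coefficients u = proj₁ (spanB u)

  coefficients-indS : RowsIndependentOn coefficients S B
  coefficients-indS = independent-factor
    (λ u j → trans (sym (proj₂ (proj₂ (spanB u)) j)) (xorSum≡sum (λ w → coefficients u w ∧ adj G w j)))
    (rowsIndependent⇒rowsIndependentOn {G = G} indS)
    (λ u w w∉B → ¬-not λ cw → false≢true (trans (sym w∉B) (proj₁ (proj₂ (spanB u)) w cw)))

covers≡xor : (F : Bicliques n k) (u v : Fin n) (i : Fin k) →
  covers F i u v ≡ (X F i u ∧ Y F i v) xor (Y F i u ∧ X F i v)
covers≡xor F u v i with X F i u in xu | Y F i u in yu
... | true  | true  = contradiction (xu , yu) (disjoint F i u)
... | true  | false = trans (∨-identityʳ _) (sym (xor-identityʳ _))
... | false | true  = refl
... | false | false = refl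

covers-diagonal : (F : Bicliques n k) (u : Fin n) (i : Fin k) → covers F i u u ≡ false
covers-diagonal F u i with X F i u in xu | Y F i u in yu
... | true  | true  = contradiction (xu , yu) (disjoint F i u)
... | true  | false = refl
... | false | true  = refl
... | false | false = refl

adj≡sum-covers : {G : Graph n} {F : Bicliques n k} → OddCover G F →
  ∀ u v → adj G u v ≡ ∑[ i < k ] covers F i u v
adj≡sum-covers {G = G} {F} cover u v with u ≟ v
... | no u≢v   = trans (sym (cover u v u≢v)) (xorSum≡sum (λ i → covers F i u v))
... | yes refl = trans (irreflex G u) (sym (sum-false (covers-diagonal F u)))

sides : Bicliques n k → Matrix n (k + k)
sides F u = (λ i → X F i u) ++ (λ i → Y F i u)

opposites : Bicliques n k → Matrix (k + k) n
opposites F t v = ((λ i → Y F i v) ++ (λ i → X F i v)) t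

module _ (F : Bicliques n k) (u : Fin n) (i : Fin k) where

  sides-↑ˡ : sides F u (i ↑ˡ k) ≡ X F i u
  sides-↑ˡ = lookup-++ˡ (λ i → X F i u) _ i

  sides-↑ʳ : sides F u (k ↑ʳ i) ≡ Y F i u
  sides-↑ʳ = lookup-++ʳ (λ i → X F i u) _ i

  opposites-↑ˡ : opposites F (i ↑ˡ k) u ≡ Y F i u
  opposites-↑ˡ = lookup-++ˡ (λ i → Y F i u) _ i

  opposites-↑ʳ : opposites F (k ↑ʳ i) u ≡ X F i u
  opposites-↑ʳ = lookup-++ʳ (λ i → Y F i u) _ i

adj≡sides·opposites : {G : Graph n} {F : Bicliques n k} → OddCover G F →
  ∀ u v → adj G u v ≡ (sides F · opposites F) u v
adj≡sides·opposites {k = k} {G = G} {F} cover u v = begin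
  adj G u v                                                 ≡⟨ adj≡sum-covers {G = G} {F} cover u v ⟩
  ∑[ i < k ] covers F i u v                                 ≡⟨ sum-cong-≗ (covers≡xor F u v) ⟩
  ∑[ i < k ] ((X F i u ∧ Y F i v) xor (Y F i u ∧ X F i v))  ≡⟨ ∑-distrib-+ XY YX ⟩
  ∑[ i < k ] XY i xor ∑[ i < k ] YX i                       ≡⟨ cong₂ _xor_ (sum-cong-≗ left) (sum-cong-≗ right) ⟨
  ∑[ i < k ] term (i ↑ˡ k) xor ∑[ i < k ] term (k ↑ʳ i)     ≡⟨ sum-↑ {k} {k} term ⟨
  (sides F · opposites F) u v                               ∎
  where
  open ≡-Reasoning
  XY YX : Fin k → Bool
  XY i = X F i u ∧ Y F i v
  YX i = Y F i u ∧ X F i v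
  term : Fin (k + k) → Bool
  term t = sides F u t ∧ opposites F t v
  left : ∀ i → term (i ↑ˡ k) ≡ XY i
  left i = cong₂ _∧_ (sides-↑ˡ F u i) (opposites-↑ˡ F v i)
  right : ∀ i → term (k ↑ʳ i) ≡ YX i
  right i = cong₂ _∧_ (sides-↑ʳ F u i) (opposites-↑ʳ F v i)

join-injective : ∀ m n → Injective _≡_ _≡_ (join m n)
join-injective m n {s} {s′} eq =
  trans (sym (splitAt-join m n s)) (trans (cong (splitAt m) eq) (splitAt-join m n s′))

theorem6 : ∀ {n : ℕ} (k : ℕ) (G : Graph n) (F : Bicliques n k) →
    Rank₂ G (2 * k) → OddCover G F →
    (B : VSet n) → RowBasis G B →
    Σ (Fin k ⊎ Fin k → Fin n) λ f →
      Injective _≡_ _≡_ f ×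
      (∀ v → (v ∈ᵥ B) ⇔ (∃ λ s → f s ≡ v)) ×
      (∀ i → f (inj₁ i) ∈ᵥ X F i) ×
      (∀ i → f (inj₂ i) ∈ᵥ Y F i)
theorem6 k G F rank cover B basis@(indB , _) =
  row ∘ join k k , join-injective k k ∘ injective , image ,
  (λ i → trans (sym (sides-↑ˡ F _ i)) (hits (i ↑ˡ k))) ,
  (λ i → trans (sym (sides-↑ʳ F _ i)) (hits (k ↑ʳ i)))
  where
  |B|≡k+k : size B ≡ k + k
  |B|≡k+k = trans (rowBasis⇒size≡rank {G = G} rank basis) (cong (k +_) (+-identityʳ k))

  sides-indB : RowsIndependentOn (sides F) B full
  sides-indB = independent-factor (adj≡sides·opposites {G = G} {F} cover)
    (rowsIndependent⇒rowsIndependentOn {G = G} indB) λ _ _ ()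

  open Transversal (independent-square⇒transversal sides-indB |B|≡k+k)

  image : ∀ v → (v ∈ᵥ B) ⇔ (∃ λ s → row (join k k s) ≡ v)
  image v = mk⇔
    (λ v∈B → let (t , eq) = onto v v∈B in splitAt k t , trans (cong row (join-splitAt k k t)) eq)
    (λ (s , eq) → subst (_∈ᵥ B) eq (row-∈ (join k k s)))
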